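{- Let $k\ge 1$ and let $A,b,C$ be as in the context. The utility vector $u$ of any almost-feasible ordinal basis $D$ of $C$ satisfies $u_i\in\{0,1,\dots,k\}$ for all $i\ne 1$.
   Context: Men $m_1,\dots,m_k$, women $w_1,\dots,w_k$; $v_i=m_i$, $v_{k+i}=w_i$, $n=2k$; all preferences strict and complete. Edges: loops $e_1,\dots,e_n$ ($e_i$ at $v_i$) and $k^2$ valid edges $(m,w)$; each agent prefers each valid edge containing it to its loop. Columns indexed by $[n+k^2]$: column $j\le n$ is loop $e_j$; for $i\in[k]$ columns $n+k(i-1)+1,\dots,n+ki$ are the edges $(m_i,w)$ in decreasing order of $m_i$'s preference. $A$: $a_{ij}=1$ iff $v_i\in e_j$; $b=(1,\dots,1)^T$. $C=(c_{ij})$: if $v_i\in e_j$ and $e_j$ is the $\ell$-th best of the $k+1$ edges containing $v_i$ (loop last), $c_{ij}=k+1-\ell$; if $e_j$ is a valid edge not containing $v_i$, $c_{ij}\in\{k+1,\dots,k^2\}$ assigned in decreasing order from left to right; if $e_j$ is a loop, $j\ne i$, $c_{ij}\in\{k^2+1,\dots,k^2+2k-1\}$ assigned in decreasing order from left to right. Ordinal basis: $n$ columns $D$ such that, with utility vector $u_i=\min_{j\in D}c_{ij}$, every column $h$ has some $i$ with $u_i\ge c_{ih}$. Feasible basis: $n$ linearly independent columns $B$ of $A$ with $A_B^{ -1}b\ge0$. $D$ is almost-feasible if $1\notin D$ and there is a feasible basis $B$ with $1\in B$ and $|B\cap D|=n-1$. -}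

module Defs where

open import Data.Nat using (ℕ; zero; suc; _+_; _*_; _∸_; _<ᵇ_; _⊓_) renaming (_≤_ to _ℕ≤_)
open import Data.Bool using (Bool; true; false; if_then_else_; _∧_; not)
open import Data.Fin using (Fin; zero; suc; toℕ; splitAt; remQuot; _≟_)
open import Data.Fin.Subset using (Subset; _∈_; _∉_; _∩_; ∣_∣)
open import Data.Fin.Permutation using (Permutation′; _⟨$⟩ʳ_; _⟨$⟩ˡ_)
open import Data.Sum using (_⊎_; inj₁; inj₂)
open import Data.Product using (Σ; ∃; _×_; _,_)
open import Data.Rational using (ℚ; 0ℚ; 1ℚ) renaming (_≤_ to _ℚ≤_; _+_ to _+ℚ_; _*_ to _*ℚ_)
open import Data.Maybe using (Maybe; just; nothing; fromMaybe)
open import Data.Vec using ([]; _∷_)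
open import Relation.Nullary.Decidable using (⌊_⌋)
open import Relation.Binary.PropositionalEquality using (_≡_)

-- Agents: Fin (k + k); via splitAt k, inj₁ i = man m_(i+1), inj₂ i = woman w_(i+1).
-- So agent index a corresponds to v_(toℕ a + 1).
Agent : ℕ → Set
Agent k = Fin (k + k)

-- Columns: Fin ((k + k) + k * k); column index j corresponds to column toℕ j + 1.
ncols : ℕ → ℕ
ncols k = (k + k) + k * k

Col : ℕ → Set
Col k = Fin (ncols k)

-- A preference profile: for man i, (mp i ⟨$⟩ʳ p) is the woman at position p
-- (p = 0 is the most preferred); for woman w, (wp w ⟨$⟩ʳ q) is the man at
-- position q. Strict complete orders on k alternatives = permutations.
-- (Every agent prefers all its valid edges to its loop: the loop is last.)
Prefs : ℕ → Set
Prefs k = Fin k → Permutation′ k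

data Edge (k : ℕ) : Set where
  loop  : Agent k → Edge k
  valid : Fin k → Fin k → Edge k

isLoop : ∀ {k} → Edge k → Bool
isLoop (loop _)    = true
isLoop (valid _ _) = false

edgeOf : ∀ k → Prefs k → Col k → Edge k
edgeOf k mp j with splitAt (k + k) j
... | inj₁ a = loop a
... | inj₂ e with remQuot {k} k e
...   | (i , p) = valid i (mp i ⟨$⟩ʳ p)

inEdge : ∀ k → Agent k → Edge k → Bool
inEdge k a (loop b) = ⌊ a ≟ b ⌋
inEdge k a (valid m w) with splitAt k a
... | inj₁ x = ⌊ x ≟ m ⌋
... | inj₂ y = ⌊ y ≟ w ⌋

-- ℓ = rank (1-based) of e among the k+1 edges containing v_a (loop last),
-- assuming v_a ∈ e
rankIn : ∀ k → Prefs k → Prefs k → Agent k → Edge k → ℕ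
rankIn k mp wp a (loop _) = suc k
rankIn k mp wp a (valid m w) with splitAt k a
... | inj₁ _ = suc (toℕ (mp m ⟨$⟩ˡ w))
... | inj₂ _ = suc (toℕ (wp w ⟨$⟩ˡ m))

count : ∀ {m} → (Fin m → Bool) → ℕ
count {zero}  P = 0
count {suc m} P = (if P zero then 1 else 0) + count {m} (λ j → P (suc j))

countLeft : ∀ {m} → (Fin m → Bool) → Fin m → ℕ
countLeft P j = count (λ j′ → P j′ ∧ (toℕ j′ <ᵇ toℕ j))

Cmat : ∀ k → Prefs k → Prefs k → Agent k → Col k → ℕ
Cmat k mp wp a j =
  if inEdge k a e then suc k ∸ rankIn k mp wp a e
  else if isLoop e
       then (k * k + (k + k ∸ 1)) ∸
              countLeft (λ j′ → isLoop (E j′) ∧ not (inEdge k a (E j′))) j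
       else (k * k) ∸
              countLeft (λ j′ → not (isLoop (E j′)) ∧ not (inEdge k a (E j′))) j
  where
  E : Col k → Edge k
  E = edgeOf k mp
  e : Edge k
  e = E j

Amat : ∀ k → Prefs k → Agent k → Col k → ℚ
Amat k mp a j = if inEdge k a (edgeOf k mp j) then 1ℚ else 0ℚ

minOverM : ∀ {m} → (Fin m → ℕ) → Subset m → Maybe ℕ
minOverM f []           = nothing
minOverM f (true  ∷ s) = just (comb (f zero) (minOverM (λ j → f (suc j)) s))
  where
  comb : ℕ → Maybe ℕ → ℕ
  comb x nothing  = x
  comb x (just y) = x ⊓ y
minOverM f (false ∷ s) = minOverM (λ j → f (suc j)) s

-- min_{j ∈ S} f j ; the default 0 for empty S never matters below since the
-- subsets used have n = 2k ≥ 2 elements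
minOver : ∀ {m} → (Fin m → ℕ) → Subset m → ℕ
minOver f s = fromMaybe 0 (minOverM f s)

utility : ∀ k → Prefs k → Prefs k → Subset (ncols k) → Agent k → ℕ
utility k mp wp D a = minOver (Cmat k mp wp a) D

OrdinalBasis : ∀ k → Prefs k → Prefs k → Subset (ncols k) → Set
OrdinalBasis k mp wp D =
  ∣ D ∣ ≡ k + k ×
  (∀ (h : Col k) → ∃ λ (a : Agent k) → Cmat k mp wp a h ℕ≤ utility k mp wp D a)

sumℚ : ∀ {m} → (Fin m → ℚ) → ℚ
sumℚ {zero}  f = 0ℚ
sumℚ {suc m} f = f zero +ℚ sumℚ {m} (λ j → f (suc j))

Aapply : ∀ k → Prefs k → (Col k → ℚ) → Agent k → ℚ
Aapply k mp x a = sumℚ (λ j → Amat k mp a j *ℚ x j)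

SupportedOn : ∀ {m} → Subset m → (Fin m → ℚ) → Set
SupportedOn B x = ∀ j → j ∉ B → x j ≡ 0ℚ

LinIndep : ∀ k → Prefs k → Subset (ncols k) → Set
LinIndep k mp B =
  ∀ (x : Col k → ℚ) → SupportedOn B x → (∀ a → Aapply k mp x a ≡ 0ℚ) → ∀ j → x j ≡ 0ℚ

-- B is a feasible basis: n linearly independent columns of A with
-- A_B⁻¹ b ≥ 0, i.e. the (unique) solution x_B of A_B x_B = b = (1,…,1) is ≥ 0
FeasibleBasis : ∀ k → Prefs k → Subset (ncols k) → Set
FeasibleBasis k mp B =
  ∣ B ∣ ≡ k + k × LinIndep k mp B ×
  (∃ λ (x : Col k → ℚ) → SupportedOn B x ×
     (∀ a → Aapply k mp x a ≡ 1ℚ) × (∀ j → 0ℚ ℚ≤ x j))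

-- agent v_1 (= m_1) and column 1 (= loop e_1); need k ≥ 1
v₁ : ∀ k → 1 ℕ≤ k → Agent k
v₁ (suc k) _ = zero

col₁ : ∀ k → 1 ℕ≤ k → Col k
col₁ (suc k) _ = zero

AlmostFeasible : ∀ k → (hk : 1 ℕ≤ k) → Prefs k → Subset (ncols k) → Set
AlmostFeasible k hk mp D =
  col₁ k hk ∉ D ×
  (∃ λ (B : Subset (ncols k)) →
     FeasibleBasis k mp B × col₁ k hk ∈ B × ∣ B ∩ D ∣ ≡ (k + k) ∸ 1)

-- Since (A x)_a = 1 for the basic solution x of the feasible basis B, some column j of B
-- has a_aj x_j ≠ 0: the edge e_j contains v_a, so c_aj ≤ k. As |B ∩ D| = n - 1 and
-- 1 ∈ B ∖ D, the only column of B outside D is the loop e_1, which does not contain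
-- v_a for a ≠ 1; hence j ∈ D and u_a ≤ c_aj ≤ k.
module Submission where

open import Defs
open import Data.Nat using (ℕ; _≤_; _+_; _∸_; z≤n; s≤s)
open import Data.Nat.Properties using (≤-refl; ≤-trans; m⊓n≤m; m⊓n≤n; ∸-monoʳ-≤; m≤n+m∸n; <⇒≱)
open import Data.Fin using (Fin; zero; suc; _≟_; splitAt)
open import Data.Fin.Properties using (¬∀⟶∃¬)
open import Data.Fin.Subset using (Subset; _∈_; _∉_; _∩_; _-_; ∣_∣; inside; outside)
open import Data.Fin.Subset.Properties
  using (_∈?_; x∈p∩q⁻; x∈p∧x≢y⇒x∈p-y; x∈p⇒∣p-x∣<∣p∣; p⊆q⇒∣p∣≤∣q∣)
open import Data.Vec.Base using (_∷_; here; there)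
open import Data.Bool using (true; false)
open import Data.Maybe using (just; nothing)
open import Data.Product using (∃; _×_; _,_)
open import Data.Sum using (inj₁; inj₂)
open import Relation.Nullary using (yes; no; contradiction)
open import Data.Rational using (ℚ; 0ℚ; 1ℚ) renaming (_+_ to _+ℚ_; _*_ to _*ℚ_)
open import Data.Rational.Properties using (+-identityˡ; *-zeroˡ; *-zeroʳ; 1≢0) renaming (_≟_ to _≟ℚ_)
open import Relation.Binary.PropositionalEquality
  using (_≡_; _≢_; refl; sym; trans; cong; cong₂; subst; module ≡-Reasoning)

sumℚ-zero : ∀ {m} (f : Fin m → ℚ) → (∀ j → f j ≡ 0ℚ) → sumℚ f ≡ 0ℚ
sumℚ-zero {ℕ.zero}  f f≡0 = refl
sumℚ-zero {ℕ.suc m} f f≡0 = begin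
  f zero +ℚ sumℚ (λ j → f (suc j)) ≡⟨ cong₂ _+ℚ_ (f≡0 zero) (sumℚ-zero _ (λ j → f≡0 (suc j))) ⟩
  0ℚ +ℚ 0ℚ                         ≡⟨ +-identityˡ 0ℚ ⟩
  0ℚ                               ∎
  where open ≡-Reasoning

sumℚ≢0⇒∃≢0 : ∀ {m} (f : Fin m → ℚ) → sumℚ f ≢ 0ℚ → ∃ λ j → f j ≢ 0ℚ
sumℚ≢0⇒∃≢0 {m} f sum≢0 =
  ¬∀⟶∃¬ m (λ j → f j ≡ 0ℚ) (λ j → f j ≟ℚ 0ℚ) (λ f≡0 → sum≢0 (sumℚ-zero f f≡0))

minOverM-≤ : ∀ {m} (f : Fin m → ℕ) (D : Subset m) {j : Fin m} → j ∈ D →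
             ∃ λ v → minOverM f D ≡ just v × v ≤ f j
minOverM-≤ f (inside ∷ D) here with minOverM (λ j → f (suc j)) D
... | nothing = f zero , refl , ≤-refl
... | just y  = _ , refl , m⊓n≤m (f zero) y
minOverM-≤ f (inside ∷ D) (there j∈D) with minOverM-≤ (λ j → f (suc j)) D j∈D
... | v , eq , v≤ rewrite eq = _ , refl , ≤-trans (m⊓n≤n (f zero) v) v≤
minOverM-≤ f (outside ∷ D) (there j∈D) = minOverM-≤ (λ j → f (suc j)) D j∈D

minOver-≤ : ∀ {m} (f : Fin m → ℕ) (D : Subset m) {j : Fin m} → j ∈ D → minOver f D ≤ f j
minOver-≤ f D j∈D with minOverM-≤ f D j∈D
... | v , eq , v≤ rewrite eq = v≤

2+∣p∩q∣≤∣p∣ : ∀ {n} (p q : Subset n) {i j : Fin n} →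
              i ∈ p → i ∉ q → j ∈ p → j ∉ q → i ≢ j → 2 + ∣ p ∩ q ∣ ≤ ∣ p ∣
2+∣p∩q∣≤∣p∣ p q {i} {j} i∈p i∉q j∈p j∉q i≢j =
  ≤-trans (s≤s (≤-trans (s≤s (p⊆q⇒∣p∣≤∣q∣ p∩q⊆p-i-j)) (x∈p⇒∣p-x∣<∣p∣ j∈p-i)))
          (x∈p⇒∣p-x∣<∣p∣ i∈p)
  where
  j∈p-i : j ∈ p - i
  j∈p-i = x∈p∧x≢y⇒x∈p-y j∈p (λ j≡i → i≢j (sym j≡i))

  p∩q⊆p-i-j : ∀ {x} → x ∈ p ∩ q → x ∈ p - i - j
  p∩q⊆p-i-j x∈p∩q with x∈p∩q⁻ p q x∈p∩q
  ... | x∈p , x∈q =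
    x∈p∧x≢y⇒x∈p-y (x∈p∧x≢y⇒x∈p-y x∈p (λ { refl → i∉q x∈q })) (λ { refl → j∉q x∈q })

∣p∩q∣≡∣p∣∸1⇒∉q-unique : ∀ {n} (p q : Subset n) → ∣ p ∩ q ∣ ≡ ∣ p ∣ ∸ 1 → {i j : Fin n} →
                         i ∈ p → i ∉ q → j ∈ p → j ∉ q → i ≡ j
∣p∩q∣≡∣p∣∸1⇒∉q-unique p q card {i} {j} i∈p i∉q j∈p j∉q with i ≟ j
... | yes i≡j = i≡j
... | no  i≢j = contradiction (m≤n+m∸n ∣ p ∣ 1) (<⇒≱ (subst (λ t → 2 + t ≤ ∣ p ∣) card
                  (2+∣p∩q∣≤∣p∣ p q i∈p i∉q j∈p j∉q i≢j)))

rankIn-positive : ∀ k mp wp a e → 1 ≤ rankIn k mp wp a e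
rankIn-positive k mp wp a (loop _) = s≤s z≤n
rankIn-positive k mp wp a (valid m w) with splitAt k a
... | inj₁ _ = s≤s z≤n
... | inj₂ _ = s≤s z≤n

inEdge⇒Cmat≤k : ∀ k mp wp a j → inEdge k a (edgeOf k mp j) ≡ true → Cmat k mp wp a j ≤ k
inEdge⇒Cmat≤k k mp wp a j v∈e rewrite v∈e =
  ∸-monoʳ-≤ (1 + k) (rankIn-positive k mp wp a (edgeOf k mp j))

Amat*≢0⇒inEdge : ∀ k mp a j (y : ℚ) → Amat k mp a j *ℚ y ≢ 0ℚ → inEdge k a (edgeOf k mp j) ≡ true
Amat*≢0⇒inEdge k mp a j y a*y≢0 with inEdge k a (edgeOf k mp j)
... | true  = refl
... | false = contradiction (*-zeroˡ y) a*y≢0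

*≢0⇒≢0ʳ : ∀ (z y : ℚ) → z *ℚ y ≢ 0ℚ → y ≢ 0ℚ
*≢0⇒≢0ʳ z y z*y≢0 y≡0 = z*y≢0 (trans (cong (z *ℚ_) y≡0) (*-zeroʳ z))

inEdge-loop₁⇒v₁ : ∀ k (hk : 1 ≤ k) mp a → inEdge k a (edgeOf k mp (col₁ k hk)) ≡ true → a ≡ v₁ k hk
inEdge-loop₁⇒v₁ (ℕ.suc k) (s≤s z≤n) mp zero    _  = refl
inEdge-loop₁⇒v₁ (ℕ.suc k) (s≤s z≤n) mp (suc a) ()

lemma9 : (k : ℕ) (hk : 1 ≤ k) (mp wp : Prefs k) (D : Subset (ncols k)) →
    OrdinalBasis k mp wp D → AlmostFeasible k hk mp D →
    ∀ (a : Agent k) → a ≢ v₁ k hk → utility k mp wp D a ≤ k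
lemma9 k hk mp wp D _ (c₁∉D , B , (∣B∣≡n , _ , x , x-on-B , Ax≡1 , _) , c₁∈B , ∣B∩D∣≡n∸1) a a≢v₁
  with sumℚ≢0⇒∃≢0 _ (λ Ax≡0 → 1≢0 (trans (sym (Ax≡1 a)) Ax≡0))
... | j , a·xj≢0 with Amat*≢0⇒inEdge k mp a j (x j) a·xj≢0 | j ∈? B | j ∈? D
...   | _     | no j∉B  | _       = contradiction (x-on-B j j∉B) (*≢0⇒≢0ʳ (Amat k mp a j) (x j) a·xj≢0)
...   | v∈eⱼ | yes _   | yes j∈D = ≤-trans (minOver-≤ _ D j∈D) (inEdge⇒Cmat≤k k mp wp a j v∈eⱼ)
...   | v∈eⱼ | yes j∈B | no  j∉D = contradiction (inEdge-loop₁⇒v₁ k hk mp a v∈e₁) a≢v₁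
  where
  j≡c₁ : j ≡ col₁ k hk
  j≡c₁ = ∣p∩q∣≡∣p∣∸1⇒∉q-unique B D (subst (λ n → ∣ B ∩ D ∣ ≡ n ∸ 1) (sym ∣B∣≡n) ∣B∩D∣≡n∸1)
           j∈B j∉D c₁∈B c₁∉D

  v∈e₁ : inEdge k a (edgeOf k mp (col₁ k hk)) ≡ true
  v∈e₁ = subst (λ c → inEdge k a (edgeOf k mp c) ≡ true) j≡c₁ v∈eⱼ
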